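{- Let $M$ be a binary matroid on a finite set $E$, $X\subseteq E$ with $e\in X$, and $M^e_X$ the es-splitting matroid. Let $A'\subseteq E\cup\{a,\gamma\}$ and $A=A'\setminus\{a,\gamma\}$. If $A'=A\cup\{\gamma\}$, $cl(A)$ contains no OX-circuit of $M$, and $e\notin cl(A)$, then $cl'(A')=cl(A)\cup\{\gamma\}\cup\mathcal T(A)$.
   Context: Let $a,\gamma\notin E$ be two new elements. Let $A_M$ be a matrix over GF(2) representing $M$ (columns indexed by $E$). Form $A^e_X$ from $A_M$ by appending a new row $\delta_X$ whose entries are $1$ in the columns of elements of $X$ and $0$ elsewhere, and then appending two new columns: a column $a$ which is $0$ everywhere except for a $1$ in the new last row, and a column $\gamma$ which is the GF(2)-sum of the columns $a$ and $e$. The es-splitting matroid $M^e_X$ is the vector matroid of $A^e_X$, with ground set $E\cup\{a,\gamma\}$. $cl$ and $cl'$ denote the closure operators of $M$ and $M^e_X$. An OX-circuit of $M$ is a circuit of $M$ containing an odd number of elements of $X$; a set "contains an OX-circuit" if some OX-circuit of $M$ is a subset of it. For $A\subseteq E$: $\mathcal T(A)=\{x\in E\setminus A: x\neq e$ and there is an OX-circuit $C$ of $M$ with $x,e\in C$ and $C\subseteq A\cup\{e,x\}\}$. -}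

module Defs where

open import Data.Bool using (Bool; true; false; _∧_; _xor_)
open import Data.Nat using (ℕ; zero; suc; _%_)
open import Data.Fin using (Fin; zero; suc)
open import Data.Fin.Subset using (Subset; _∈_; _∉_; _⊆_; _⊂_; _∪_; _∩_; ⁅_⁆; Nonempty; ∣_∣)
open import Data.Vec using (Vec; _∷_; lookup; tail)
open import Data.Product using (Σ; ∃; _×_; _,_)
open import Data.Sum using (_⊎_)
open import Relation.Binary.PropositionalEquality using (_≡_; _≢_)
open import Relation.Nullary using (¬_)
open import Function using (_∘_)

-- A matrix over GF(2) with m rows and columns indexed by Fin k
-- (GF(2) is Bool with xor as addition and ∧ as multiplication).
Matrix : ℕ → ℕ → Set
Matrix m k = Fin m → Fin k → Bool

sumB : ∀ {k} → (Fin k → Bool) → Bool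
sumB {zero}  f = false
sumB {suc k} f = f zero xor sumB (f ∘ suc)

colSum : ∀ {m k} → Matrix m k → Subset k → Fin m → Bool
colSum A T i = sumB (λ j → lookup T j ∧ A i j)

-- Vector matroid M[A] of a GF(2)-matrix A.
-- S is dependent iff some nonempty subset of S has columns summing to 0
-- (over GF(2) a nontrivial linear combination is exactly a nonempty subset).
Dependent : ∀ {m k} → Matrix m k → Subset k → Set
Dependent A S = ∃ λ T → T ⊆ S × Nonempty T × (∀ i → colSum A T i ≡ false)

Independent : ∀ {m k} → Matrix m k → Subset k → Set
Independent A S = ¬ Dependent A S

Circuit : ∀ {m k} → Matrix m k → Subset k → Set
Circuit A C = Dependent A C × (∀ T → T ⊂ C → Independent A T)

InCl : ∀ {m k} → Matrix m k → Subset k → Fin k → Set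
InCl A S x = x ∈ S ⊎ (∃ λ C → Circuit A C × x ∈ C × C ⊆ S ∪ ⁅ x ⁆)

SubCl : ∀ {m k} → Matrix m k → Subset k → Subset k → Set
SubCl A S C = ∀ x → x ∈ C → InCl A S x

OXCircuit : ∀ {m k} → Matrix m k → Subset k → Subset k → Set
OXCircuit A X C = Circuit A C × ∣ C ∩ X ∣ % 2 ≡ 1

InT : ∀ {m n} → Matrix m n → Subset n → Fin n → Subset n → Fin n → Set
InT M X e S x =
  x ∉ S × x ≢ e ×
  (∃ λ C → OXCircuit M X C × x ∈ C × e ∈ C × C ⊆ S ∪ ⁅ e ⁆ ∪ ⁅ x ⁆)

-- Ground set of M^e_X is Fin (2 + n): index 0 is a, index 1 is γ,
-- and x ∈ E = Fin n is index suc (suc x).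
aE : ∀ {n} → Fin (suc (suc n))
aE = zero

γE : ∀ {n} → Fin (suc (suc n))
γE = suc zero

ι : ∀ {n} → Fin n → Fin (suc (suc n))
ι x = suc (suc x)

-- A' ∖ {a, γ}, viewed as a subset of E
restrictE : ∀ {n} → Subset (suc (suc n)) → Subset n
restrictE S = tail (tail S)

liftE : ∀ {n} → Subset n → Subset (suc (suc n))
liftE S = false ∷ false ∷ S

-- The matrix A^e_X.  The new row δ_X is row 0 (row order is immaterial).
module _ {m n : ℕ} (M : Matrix m n) (X : Subset n) (e : Fin n) where
  colEx : Fin (suc m) → Fin n → Bool
  colEx zero    x = lookup X x
  colEx (suc r) x = M r x

  colAx : Fin (suc m) → Bool
  colAx zero    = true
  colAx (suc r) = false

  esMatrix : Matrix (suc m) (suc (suc n))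
  esMatrix i zero          = colAx i
  esMatrix i (suc zero)    = colAx i xor colEx i e
  esMatrix i (suc (suc x)) = colEx i x

-- Over GF(2), y ∈ cl′(A ∪ {γ}) iff the column of y is the sum of the columns of some T ⊆ A,
-- plus possibly the column of γ, which is (0, e) since e ∈ X.
-- Sums of columns of M that vanish are cycles, and an odd cycle (odd number of elements of X)
-- contains an OX-circuit.  Without γ, the M-rows put x in cl(A), and the δ_X-row is then
-- automatic since the cycle T + x lies in cl(A) and so is even; it also rules out y = a.
-- With γ, y = a would put e in cl(A), while y = x makes T + e + x an odd cycle inside
-- A ∪ {e, x}; one of its OX-circuits must meet {e, x}, and according to whether it contains
-- e, x or both, e ∈ cl(A) (impossible), x ∈ cl(A), or x ∈ 𝒯(A).
module Submission where

open import Defs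
open import Algebra.Bundles using (CommutativeRing)
open import Data.Bool using (Bool; true; false; not; _∧_; _xor_; if_then_else_)
open import Data.Bool.Properties
  using (xor-∧-commutativeRing; xor-same; xor-identityʳ; xor-assoc; xor-inverseʳ;
         ∧-distribʳ-xor; ∧-zeroʳ)
  renaming (_≟_ to _≟ᴮ_)
open import Data.Empty using (⊥-elim)
open import Data.Fin using (Fin; zero; suc)
open import Data.Fin.Properties using (all?) renaming (_≟_ to _≟ᶠ_)
open import Data.Fin.Subset
  using (Subset; _∈_; _∉_; _⊆_; _⊂_; _∪_; _∩_; ⁅_⁆; Nonempty; Empty; ∣_∣; ⊥)
open import Data.Fin.Subset.Induction using (⊂-wellFounded)
open import Data.Fin.Subset.Properties
  using (_∈?_; _⊆?_; _⊂?_; nonempty?; anySubset?; ⊆-refl; ⊆-trans; ⊆-antisym; Empty-unique;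
         drop-there; drop-∷-⊆; out⊆; in⊆in; x∈⁅x⁆; x∈⁅y⁆⇒x≡y; x∈p∪q⁺; x∈p∪q⁻)
open import Data.Nat using (ℕ; zero; suc; _+_; _%_)
open import Data.Nat.DivMod using (%-distribˡ-+)
open import Data.Product using (∃; _×_; _,_; proj₁; proj₂)
import Data.Product as Prod
import Data.Sum as Sum
open import Data.Sum using (_⊎_; inj₁; inj₂; [_,_]′)
open import Data.Vec using (_∷_; []; lookup; zipWith; here; there)
open import Data.Vec.Properties using ([]=⇒lookup; ∷-injectiveˡ; ∷-injectiveʳ)
open import Function using (_∘_; id; case_of_)
open import Function.Bundles using (_⇔_; mk⇔; Equivalence)
open import Induction.WellFounded using (Acc; acc)
open import Relation.Binary.PropositionalEquality
open import Relation.Nullary using (¬_; Dec; yes; no)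
open import Relation.Nullary.Decidable using (_×-dec_)
open import Relation.Unary using (Decidable)

open import Algebra.Properties.CommutativeSemigroup
  (CommutativeRing.+-commutativeSemigroup xor-∧-commutativeRing) using (interchange)

private
  variable
    k : ℕ
    S T : Subset k
    j : Fin k

xor-cancelˡ : ∀ x y → x xor x xor y ≡ y
xor-cancelˡ x y = trans (sym (xor-assoc x x y)) (cong (_xor y) (xor-same x))

xor-moveˡ : ∀ x {y z} → x xor y ≡ z → y ≡ x xor z
xor-moveˡ x {y} x⊕y≡z = trans (sym (xor-cancelˡ x y)) (cong (x xor_) x⊕y≡z)

xor≡false⇒≡ : ∀ {x y} → x xor y ≡ false → x ≡ y
xor≡false⇒≡ {x} x⊕y≡0 = sym (trans (xor-moveˡ x x⊕y≡0) (xor-identityʳ x))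

infixl 6 _⊕_
_⊕_ : Subset k → Subset k → Subset k
_⊕_ = zipWith _xor_

∈-⊕⁻ : ∀ (S T : Subset k) → j ∈ S ⊕ T → (j ∈ S × j ∉ T) ⊎ (j ∉ S × j ∈ T)
∈-⊕⁻ (true ∷ S) (false ∷ T) here = inj₁ (here , λ ())
∈-⊕⁻ (false ∷ S) (true ∷ T) here = inj₂ ((λ ()) , here)
∈-⊕⁻ (s ∷ S) (t ∷ T) (there p) =
  Sum.map (Prod.map there (_∘ drop-there)) (Prod.map (_∘ drop-there) there) (∈-⊕⁻ S T p)

∈-⊕⁺ˡ : j ∈ S → j ∉ T → j ∈ S ⊕ T
∈-⊕⁺ˡ {T = false ∷ T} here j∉T = here
∈-⊕⁺ˡ {T = true ∷ T} here j∉T = ⊥-elim (j∉T here)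
∈-⊕⁺ˡ {T = t ∷ T} (there j∈S) j∉T = there (∈-⊕⁺ˡ j∈S (j∉T ∘ there))

∈-⊕⁺ʳ : j ∉ S → j ∈ T → j ∈ S ⊕ T
∈-⊕⁺ʳ {S = false ∷ S} j∉S here = here
∈-⊕⁺ʳ {S = true ∷ S} j∉S here = ⊥-elim (j∉S here)
∈-⊕⁺ʳ {S = s ∷ S} j∉S (there j∈T) = there (∈-⊕⁺ʳ (j∉S ∘ there) j∈T)

∈-⊕-⊆⁻ : T ⊆ S → j ∈ S ⊕ T → j ∈ S × j ∉ T
∈-⊕-⊆⁻ {T = T} {S = S} T⊆S j∈S⊕T with ∈-⊕⁻ S T j∈S⊕T
... | inj₁ j∈S∖T = j∈S∖T
... | inj₂ (j∉S , j∈T) = ⊥-elim (j∉S (T⊆S j∈T))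

⊕-⊂ : T ⊆ S → Nonempty T → S ⊕ T ⊂ S
⊕-⊂ T⊆S (x , x∈T) =
  (λ j∈S⊕T → proj₁ (∈-⊕-⊆⁻ T⊆S j∈S⊕T)) , x , T⊆S x∈T , (λ x∈S⊕T → proj₂ (∈-⊕-⊆⁻ T⊆S x∈S⊕T) x∈T)

∈-∪⁅⁆⁻ : ∀ (P : Subset k) y → j ∈ P ∪ ⁅ y ⁆ → j ∈ P ⊎ j ≡ y
∈-∪⁅⁆⁻ P y = Sum.map₂ (x∈⁅y⁆⇒x≡y y) ∘ x∈p∪q⁻ P ⁅ y ⁆

∈-∪⁅⁆⁺ : ∀ {P : Subset k} {y} → j ∈ P ⊎ j ≡ y → j ∈ P ∪ ⁅ y ⁆
∈-∪⁅⁆⁺ (inj₁ j∈P) = x∈p∪q⁺ (inj₁ j∈P)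
∈-∪⁅⁆⁺ (inj₂ refl) = x∈p∪q⁺ (inj₂ (x∈⁅x⁆ _))

∈-∪⁅⁆∪⁅⁆⁻ : ∀ (P : Subset k) y z → j ∈ P ∪ ⁅ y ⁆ ∪ ⁅ z ⁆ → j ∈ P ⊎ j ≡ y ⊎ j ≡ z
∈-∪⁅⁆∪⁅⁆⁻ P y z =
  Sum.map₂ (Sum.map (x∈⁅y⁆⇒x≡y y) (x∈⁅y⁆⇒x≡y z) ∘ x∈p∪q⁻ ⁅ y ⁆ ⁅ z ⁆) ∘ x∈p∪q⁻ P (⁅ y ⁆ ∪ ⁅ z ⁆)

∈-∪⁅⁆∪⁅⁆⁺ : ∀ {P : Subset k} {y z} → j ∈ P ⊎ j ≡ y ⊎ j ≡ z → j ∈ P ∪ ⁅ y ⁆ ∪ ⁅ z ⁆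
∈-∪⁅⁆∪⁅⁆⁺ (inj₁ j∈P) = x∈p∪q⁺ (inj₁ j∈P)
∈-∪⁅⁆∪⁅⁆⁺ (inj₂ j≡y⊎j≡z) = x∈p∪q⁺ (inj₂ (∈-∪⁅⁆⁺ (Sum.map₁ (λ { refl → x∈⁅x⁆ _ }) j≡y⊎j≡z)))

∈-⊕⁅⁆⁻ : ∀ (S : Subset k) y → j ∈ S ⊕ ⁅ y ⁆ → j ∈ S ⊎ j ≡ y
∈-⊕⁅⁆⁻ S y = Sum.map proj₁ (x∈⁅y⁆⇒x≡y y ∘ proj₂) ∘ ∈-⊕⁻ S ⁅ y ⁆

∈-⊕⁅⁆⁅⁆⁻ : ∀ (S : Subset k) y z → j ∈ S ⊕ ⁅ y ⁆ ⊕ ⁅ z ⁆ → j ∈ S ⊎ j ≡ y ⊎ j ≡ z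
∈-⊕⁅⁆⁅⁆⁻ S y z j∈ with ∈-⊕⁅⁆⁻ (S ⊕ ⁅ y ⁆) z j∈
... | inj₁ j∈S⊕y = Sum.map₂ inj₁ (∈-⊕⁅⁆⁻ S y j∈S⊕y)
... | inj₂ j≡z = inj₂ (inj₂ j≡z)

⊕⁅⁆⁅⁆-⊆ : ∀ {S P : Subset k} {y z} → S ⊆ P ∪ ⁅ y ⁆ ∪ ⁅ z ⁆ → y ∈ S → z ∈ S → y ≢ z →
           S ⊕ ⁅ y ⁆ ⊕ ⁅ z ⁆ ⊆ P
⊕⁅⁆⁅⁆-⊆ {S = S} {P} {y} {z} S⊆ y∈S z∈S y≢z j∈ with ∈-⊕⁻ (S ⊕ ⁅ y ⁆) ⁅ z ⁆ j∈
... | inj₂ (j∉S⊕y , j∈⁅z⁆) rewrite x∈⁅y⁆⇒x≡y z j∈⁅z⁆ =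
  ⊥-elim (j∉S⊕y (∈-⊕⁺ˡ {T = ⁅ y ⁆} z∈S (y≢z ∘ sym ∘ x∈⁅y⁆⇒x≡y y)))
... | inj₁ (j∈S⊕y , j∉⁅z⁆) with ∈-⊕⁻ S ⁅ y ⁆ j∈S⊕y
...   | inj₂ (j∉S , j∈⁅y⁆) rewrite x∈⁅y⁆⇒x≡y y j∈⁅y⁆ = ⊥-elim (j∉S y∈S)
...   | inj₁ (j∈S , j∉⁅y⁆) with ∈-∪⁅⁆∪⁅⁆⁻ P y z (S⊆ j∈S)
...     | inj₁ j∈P = j∈P
...     | inj₂ (inj₁ refl) = ⊥-elim (j∉⁅y⁆ (x∈⁅x⁆ y))
...     | inj₂ (inj₂ refl) = ⊥-elim (j∉⁅z⁆ (x∈⁅x⁆ z))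

weight : (Fin k → Bool) → Subset k → Bool
weight g S = sumB (λ j → lookup S j ∧ g j)

weight-⊕ : ∀ (g : Fin k → Bool) S T → weight g (S ⊕ T) ≡ weight g S xor weight g T
weight-⊕ g [] [] = refl
weight-⊕ g (s ∷ S) (t ∷ T) = begin
  (s xor t) ∧ g zero xor weight (g ∘ suc) (S ⊕ T)
    ≡⟨ cong₂ _xor_ (∧-distribʳ-xor (g zero) s t) (weight-⊕ (g ∘ suc) S T) ⟩
  (s ∧ g zero xor t ∧ g zero) xor (weight (g ∘ suc) S xor weight (g ∘ suc) T)
    ≡⟨ interchange (s ∧ g zero) (t ∧ g zero) _ _ ⟩
  (s ∧ g zero xor weight (g ∘ suc) S) xor (t ∧ g zero xor weight (g ∘ suc) T) ∎
  where open ≡-Reasoning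

weight-⊥ : ∀ (g : Fin k → Bool) → weight g ⊥ ≡ false
weight-⊥ {zero} g = refl
weight-⊥ {suc k} g = weight-⊥ (g ∘ suc)

weight-Empty : ∀ (g : Fin k → Bool) → Empty S → weight g S ≡ false
weight-Empty g S-empty rewrite Empty-unique S-empty = weight-⊥ g

weight-⁅⁆ : ∀ (g : Fin k → Bool) y → weight g ⁅ y ⁆ ≡ g y
weight-⁅⁆ g zero = trans (cong (g zero xor_) (weight-⊥ (g ∘ suc))) (xor-identityʳ (g zero))
weight-⁅⁆ g (suc y) = weight-⁅⁆ (g ∘ suc) y

weight-⊕⁅⁆ : ∀ (g : Fin k → Bool) S y → weight g (S ⊕ ⁅ y ⁆) ≡ weight g S xor g y
weight-⊕⁅⁆ g S y = trans (weight-⊕ g S ⁅ y ⁆) (cong (weight g S xor_) (weight-⁅⁆ g y))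

weight-⊕⁅⁆⁅⁆ : ∀ (g : Fin k → Bool) S y z →
               weight g (S ⊕ ⁅ y ⁆ ⊕ ⁅ z ⁆) ≡ weight g S xor g y xor g z
weight-⊕⁅⁆⁅⁆ g S y z = begin
  weight g (S ⊕ ⁅ y ⁆ ⊕ ⁅ z ⁆)   ≡⟨ weight-⊕⁅⁆ g (S ⊕ ⁅ y ⁆) z ⟩
  weight g (S ⊕ ⁅ y ⁆) xor g z   ≡⟨ cong (_xor g z) (weight-⊕⁅⁆ g S y) ⟩
  (weight g S xor g y) xor g z   ≡⟨ xor-assoc (weight g S) (g y) (g z) ⟩
  weight g S xor g y xor g z     ∎
  where open ≡-Reasoning

parity : ∀ (C X : Subset k) → ∣ C ∩ X ∣ % 2 ≡ (if weight (lookup X) C then 1 else 0)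
parity [] [] = refl
parity (false ∷ C) (x ∷ X) = parity C X
parity (true ∷ C) (false ∷ X) = parity C X
parity (true ∷ C) (true ∷ X) = suc-parity {∣ C ∩ X ∣} (weight (lookup X) C) (parity C X)
  where
  suc-parity : ∀ {r} b → r % 2 ≡ (if b then 1 else 0) → suc r % 2 ≡ (if not b then 1 else 0)
  suc-parity {r} b r%2 =
    trans (trans (%-distribˡ-+ 1 r 2) (cong (λ q → (1 + q) % 2) r%2)) (one+ b)
    where
    one+ : ∀ b → (1 + (if b then 1 else 0)) % 2 ≡ (if not b then 1 else 0)
    one+ false = refl
    one+ true = refl

odd⇔weight : ∀ (C X : Subset k) → ∣ C ∩ X ∣ % 2 ≡ 1 ⇔ weight (lookup X) C ≡ true
odd⇔weight C X = mk⇔ to from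
  where
  to : ∣ C ∩ X ∣ % 2 ≡ 1 → weight (lookup X) C ≡ true
  to odd with weight (lookup X) C | parity C X
  ... | true | _ = refl
  ... | false | even = case trans (sym odd) even of λ ()
  from : weight (lookup X) C ≡ true → ∣ C ∩ X ∣ % 2 ≡ 1
  from w = trans (parity C X) (cong (λ b → if b then 1 else 0) w)

module BinaryMatroid {m k : ℕ} (A : Matrix m k) where

  Cycle : Subset k → Set
  Cycle S = ∀ i → weight (A i) S ≡ false

  cycle? : Decidable Cycle
  cycle? S = all? (λ i → weight (A i) S ≟ᴮ false)

  dependent? : Decidable (Dependent A)
  dependent? S = anySubset? (λ T → T ⊆? S ×-dec nonempty? T ×-dec cycle? T)

  cycle-⊕ : Cycle S → Cycle T → Cycle (S ⊕ T)
  cycle-⊕ {S} {T} cycS cycT i = trans (weight-⊕ (A i) S T) (cong₂ _xor_ (cycS i) (cycT i))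

  circuit-nonempty : ∀ {C} → Circuit A C → Nonempty C
  circuit-nonempty ((_ , T⊆C , (x , x∈T) , _) , _) = x , T⊆C x∈T

  circuit⇒cycle : ∀ {C} → Circuit A C → Cycle C
  circuit⇒cycle {C} ((T , T⊆C , T≢∅ , cycT) , minimal) = subst Cycle (⊆-antisym T⊆C C⊆T) cycT
    where
    C⊆T : C ⊆ T
    C⊆T {x} x∈C with x ∈? T
    ... | yes x∈T = x∈T
    ... | no x∉T = ⊥-elim (minimal T (T⊆C , x , x∈C , x∉T) (T , ⊆-refl , T≢∅ , cycT))

  dependent⇒circuit : Dependent A S → ∃ λ C → Circuit A C × C ⊆ S
  dependent⇒circuit {S = S} = go S (⊂-wellFounded S)
    where
    go : ∀ S → Acc _⊂_ S → Dependent A S → ∃ λ C → Circuit A C × C ⊆ S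
    go S (acc smaller) depS with anySubset? (λ T → T ⊂? S ×-dec dependent? T)
    ... | no ∄T = S , (depS , λ T T⊂S depT → ∄T (T , T⊂S , depT)) , ⊆-refl
    ... | yes (T , T⊂S@(T⊆S , _) , depT) with go T (smaller T⊂S) depT
    ...   | C , circC , C⊆T = C , circC , ⊆-trans C⊆T T⊆S

  peel : ∀ {S C} → Cycle S → Circuit A C → C ⊆ S → Cycle (S ⊕ C) × S ⊕ C ⊂ S
  peel {S} {C} cycS circC C⊆S =
    cycle-⊕ {S = S} {T = C} cycS (circuit⇒cycle circC) ,
    ⊕-⊂ {T = C} {S = S} C⊆S (circuit-nonempty circC)

  cycle⇒circuit∋ : Cycle S → j ∈ S → ∃ λ C → Circuit A C × j ∈ C × C ⊆ S
  cycle⇒circuit∋ {S = S} = go S (⊂-wellFounded S)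
    where
    go : ∀ S → Acc _⊂_ S → Cycle S → j ∈ S → ∃ λ C → Circuit A C × j ∈ C × C ⊆ S
    go {j} S (acc smaller) cycS j∈S with dependent⇒circuit (S , ⊆-refl , (j , j∈S) , cycS)
    ... | C , circC , C⊆S with j ∈? C | peel cycS circC C⊆S
    ...   | yes j∈C | _ = C , circC , j∈C , C⊆S
    ...   | no j∉C | cycS⊕C , S⊕C⊂S@(S⊕C⊆S , _)
      with go (S ⊕ C) (smaller S⊕C⊂S) cycS⊕C (∈-⊕⁺ˡ {S = S} {T = C} j∈S j∉C)
    ...     | C′ , circC′ , j∈C′ , C′⊆S⊕C = C′ , circC′ , j∈C′ , ⊆-trans C′⊆S⊕C S⊕C⊆S

  oddCycle⇒oddCircuit : ∀ (g : Fin k → Bool) → Cycle S → weight g S ≡ true →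
                        ∃ λ C → Circuit A C × weight g C ≡ true × C ⊆ S
  oddCycle⇒oddCircuit {S = S} g = go S (⊂-wellFounded S)
    where
    go : ∀ S → Acc _⊂_ S → Cycle S → weight g S ≡ true →
         ∃ λ C → Circuit A C × weight g C ≡ true × C ⊆ S
    go S (acc smaller) cycS oddS with nonempty? S
    ... | no S-empty = case trans (sym oddS) (weight-Empty g S-empty) of λ ()
    ... | yes S≢∅ with dependent⇒circuit (S , ⊆-refl , S≢∅ , cycS)
    ...   | C , circC , C⊆S with weight g C in wC | peel cycS circC C⊆S
    ...     | true | _ = C , circC , wC , C⊆S
    ...     | false | cycS⊕C , S⊕C⊂S@(S⊕C⊆S , _)
      with go (S ⊕ C) (smaller S⊕C⊂S) cycS⊕C (trans (weight-⊕ g S C) (cong₂ _xor_ oddS wC))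
    ...       | C′ , circC′ , oddC′ , C′⊆S⊕C = C′ , circC′ , oddC′ , ⊆-trans C′⊆S⊕C S⊕C⊆S

  oddCycle⇒OXCircuit : ∀ X → Cycle S → weight (lookup X) S ≡ true →
                       ∃ λ C → OXCircuit A X C × C ⊆ S
  oddCycle⇒OXCircuit X cycS oddS with oddCycle⇒oddCircuit (lookup X) cycS oddS
  ... | C , circC , oddC , C⊆S = C , (circC , Equivalence.from (odd⇔weight C X) oddC) , C⊆S

  Spans : Subset k → Fin k → Set
  Spans S x = ∃ λ T → T ⊆ S × (∀ i → weight (A i) T ≡ A i x)

  inCl⇒spans : ∀ {x} → InCl A S x → Spans S x
  inCl⇒spans {x = x} (inj₁ x∈S) =
    ⁅ x ⁆ , (λ j∈⁅x⁆ → subst (_∈ _) (sym (x∈⁅y⁆⇒x≡y x j∈⁅x⁆)) x∈S) , (λ i → weight-⁅⁆ (A i) x)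
  inCl⇒spans {S = S} {x} (inj₂ (C , circC , x∈C , C⊆S∪x)) = C ⊕ ⁅ x ⁆ , C∖x⊆S , sums
    where
    C∖x⊆S : C ⊕ ⁅ x ⁆ ⊆ S
    C∖x⊆S j∈ with ∈-⊕⁻ C ⁅ x ⁆ j∈
    ... | inj₂ (j∉C , j∈⁅x⁆) rewrite x∈⁅y⁆⇒x≡y x j∈⁅x⁆ = ⊥-elim (j∉C x∈C)
    ... | inj₁ (j∈C , j∉⁅x⁆) with ∈-∪⁅⁆⁻ S x (C⊆S∪x j∈C)
    ...   | inj₁ j∈S = j∈S
    ...   | inj₂ refl = ⊥-elim (j∉⁅x⁆ (x∈⁅x⁆ x))
    sums : ∀ i → weight (A i) (C ⊕ ⁅ x ⁆) ≡ A i x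
    sums i = trans (weight-⊕⁅⁆ (A i) C x) (cong (_xor A i x) (circuit⇒cycle circC i))

  spans⇒cycle : ∀ {T x} → (∀ i → weight (A i) T ≡ A i x) → Cycle (T ⊕ ⁅ x ⁆)
  spans⇒cycle {T} {x} sums i =
    trans (weight-⊕⁅⁆ (A i) T x) (trans (cong (_xor A i x) (sums i)) (xor-same (A i x)))

  spans⇒inCl : ∀ {x} → Spans S x → InCl A S x
  spans⇒inCl {S = S} {x} (T , T⊆S , sums) with x ∈? S
  ... | yes x∈S = inj₁ x∈S
  ... | no x∉S
    with cycle⇒circuit∋ {S = T ⊕ ⁅ x ⁆} (spans⇒cycle {T = T} sums) (∈-⊕⁺ʳ {S = T} (x∉S ∘ T⊆S) (x∈⁅x⁆ x))
  ...   | C , circC , x∈C , C⊆T⊕x =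
            inj₂ (C , circC , x∈C , ∈-∪⁅⁆⁺ ∘ Sum.map₁ T⊆S ∘ ∈-⊕⁅⁆⁻ T x ∘ C⊆T⊕x)

module EsSplitting {m n : ℕ} (M : Matrix m n) (X : Subset n) (e : Fin n) (e∈X : e ∈ X)
  (A : Subset n)
  (noOXCircuitInClA : ¬ (∃ λ C → OXCircuit M X C × SubCl M A C))
  (e∉clA : ¬ InCl M A e) where

  open BinaryMatroid M
    using (Cycle; circuit⇒cycle; oddCycle⇒OXCircuit; inCl⇒spans; spans⇒inCl; spans⇒cycle)
  private
    Mₑ : Matrix (suc m) (suc (suc n))
    Mₑ = esMatrix M X e
    module Mₑ = BinaryMatroid Mₑ

  A∪γ : Subset (suc (suc n))
  A∪γ = false ∷ true ∷ A

  ClA∪γ∪𝒯 : Fin (suc (suc n)) → Set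
  ClA∪γ∪𝒯 y = y ≡ γE ⊎ (∃ λ x → y ≡ ι x × (InCl M A x ⊎ InT M X e A x))

  cycleInClA-even : ∀ {T} → Cycle T → SubCl M A T → weight (lookup X) T ≡ false
  cycleInClA-even {T} cycT T⊆clA with weight (lookup X) T in wT
  ... | false = refl
  ... | true with oddCycle⇒OXCircuit X cycT wT
  ...   | C , oxC , C⊆T = ⊥-elim (noOXCircuitInClA (C , oxC , λ x x∈C → T⊆clA x (C⊆T x∈C)))

  oxCircuit⇒clA⊎𝒯 : ∀ {C x} → OXCircuit M X C → C ⊆ A ∪ ⁅ e ⁆ ∪ ⁅ x ⁆ → InCl M A x ⊎ InT M X e A x
  oxCircuit⇒clA⊎𝒯 {C} {x} oxC@(circC , _) C⊆A∪e∪x = decide (x ∈? A) (e ∈? C) (x ∈? C)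
    where
    classify : ∀ {j} → j ∈ C → j ∈ A ⊎ j ≡ e ⊎ j ≡ x
    classify = ∈-∪⁅⁆∪⁅⁆⁻ A e x ∘ C⊆A∪e∪x

    within : ∀ {y} → (∀ {j} → j ∈ C → j ≡ e ⊎ j ≡ x → j ≡ y) → C ⊆ A ∪ ⁅ y ⁆
    within only-y j∈C = ∈-∪⁅⁆⁺ (Sum.map₂ (only-y j∈C) (classify j∈C))

    decide : Dec (x ∈ A) → Dec (e ∈ C) → Dec (x ∈ C) → InCl M A x ⊎ InT M X e A x
    decide (yes x∈A) _ _ = inj₁ (inj₁ x∈A)
    decide (no x∉A) (yes e∈C) (yes x∈C) with x ≟ᶠ e
    ... | no x≢e = inj₂ (x∉A , x≢e , C , oxC , x∈C , e∈C , C⊆A∪e∪x)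
    ... | yes refl = ⊥-elim (e∉clA (inj₂ (C , circC , e∈C , within λ _ → [ id , id ]′)))
    decide (no _) (yes e∈C) (no x∉C) =
      ⊥-elim (e∉clA (inj₂ (C , circC , e∈C , within λ j∈C → [ id , (λ { refl → ⊥-elim (x∉C j∈C) }) ]′)))
    decide (no _) (no e∉C) (yes x∈C) =
      inj₁ (inj₂ (C , circC , x∈C , within λ j∈C → [ (λ { refl → ⊥-elim (e∉C j∈C) }) , id ]′))
    decide (no _) (no e∉C) (no x∉C) = ⊥-elim (noOXCircuitInClA (C , oxC , λ j j∈C → inj₁ (C⊆A j∈C)))
      where
      C⊆A : C ⊆ A
      C⊆A j∈C with classify j∈C
      ... | inj₁ j∈A = j∈A
      ... | inj₂ (inj₁ refl) = ⊥-elim (e∉C j∈C)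
      ... | inj₂ (inj₂ refl) = ⊥-elim (x∉C j∈C)

  SpannedByA∪γ : Fin (suc (suc n)) → Set
  SpannedByA∪γ y = ∃ λ b → ∃ λ T → T ⊆ A × (∀ i → weight (Mₑ i) (false ∷ b ∷ T) ≡ Mₑ i y)

  inCl′⇒spanned : ∀ {y} → InCl Mₑ A∪γ y → SpannedByA∪γ y
  inCl′⇒spanned cl with Mₑ.inCl⇒spans cl
  ... | true ∷ _ , T′⊆A∪γ , _ with T′⊆A∪γ here
  ...   | ()
  inCl′⇒spanned cl | false ∷ b ∷ T , T′⊆A∪γ , sums = b , T , drop-∷-⊆ (drop-∷-⊆ T′⊆A∪γ) , sums

  spanned⇒inCl′ : ∀ {y} → SpannedByA∪γ y → InCl Mₑ A∪γ y
  spanned⇒inCl′ (b , T , T⊆A , sums) = Mₑ.spans⇒inCl (false ∷ b ∷ T , out⊆ (b∷T⊆A∪γ b) , sums)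
    where
    b∷T⊆A∪γ : ∀ b → b ∷ T ⊆ true ∷ A
    b∷T⊆A∪γ false = out⊆ T⊆A
    b∷T⊆A∪γ true = in⊆in T⊆A

  -- γ = a + e has δ_X-entry 1 + 1 = 0, as e ∈ X.
  δ-row : ∀ b T → weight (Mₑ zero) (false ∷ b ∷ T) ≡ weight (lookup X) T
  δ-row b T = cong (_xor weight (lookup X) T)
                   (trans (cong (λ Xₑ → b ∧ not Xₑ) ([]=⇒lookup e∈X)) (∧-zeroʳ b))

  spannedWithγ⇒clA⊎𝒯 : ∀ {x T} → T ⊆ A → (∀ i → weight (Mₑ i) (false ∷ true ∷ T) ≡ Mₑ i (ι x)) →
                    InCl M A x ⊎ InT M X e A x
  spannedWithγ⇒clA⊎𝒯 {x} {T} T⊆A sums with oddCycle⇒OXCircuit {S = T ⊕ ⁅ e ⁆ ⊕ ⁅ x ⁆} X cycle odd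
    where
    open ≡-Reasoning
    cycle : Cycle (T ⊕ ⁅ e ⁆ ⊕ ⁅ x ⁆)
    cycle r = begin
      weight (M r) (T ⊕ ⁅ e ⁆ ⊕ ⁅ x ⁆)        ≡⟨ weight-⊕⁅⁆⁅⁆ (M r) T e x ⟩
      weight (M r) T xor M r e xor M r x      ≡⟨ cong (_xor _) (xor-moveˡ (M r e) (sums (suc r))) ⟩
      (M r e xor M r x) xor (M r e xor M r x) ≡⟨ xor-same (M r e xor M r x) ⟩
      false                                   ∎
    odd : weight (lookup X) (T ⊕ ⁅ e ⁆ ⊕ ⁅ x ⁆) ≡ true
    odd = begin
      weight (lookup X) (T ⊕ ⁅ e ⁆ ⊕ ⁅ x ⁆)              ≡⟨ weight-⊕⁅⁆⁅⁆ (lookup X) T e x ⟩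
      weight (lookup X) T xor lookup X e xor lookup X x
        ≡⟨ cong₂ (λ u v → u xor v xor lookup X x) (trans (sym (δ-row true T)) (sums zero)) ([]=⇒lookup e∈X) ⟩
      lookup X x xor not (lookup X x)                      ≡⟨ xor-inverseʳ (lookup X x) ⟩
      true                                                 ∎
  ... | C , oxC , C⊆T⊕e⊕x =
    oxCircuit⇒clA⊎𝒯 oxC (∈-∪⁅⁆∪⁅⁆⁺ ∘ Sum.map₁ T⊆A ∘ ∈-⊕⁅⁆⁅⁆⁻ T e x ∘ C⊆T⊕e⊕x)

  spanned⇒clA∪γ∪𝒯 : ∀ y → SpannedByA∪γ y → ClA∪γ∪𝒯 y
  spanned⇒clA∪γ∪𝒯 zero (false , T , T⊆A , sums) =
    case trans (sym (cycleInClA-even (sums ∘ suc) (λ _ j∈T → inj₁ (T⊆A j∈T)))) (sums zero) of λ ()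
  spanned⇒clA∪γ∪𝒯 zero (true , T , T⊆A , sums) =
    ⊥-elim (e∉clA (spans⇒inCl (T , T⊆A , λ r → sym (xor≡false⇒≡ (sums (suc r))))))
  spanned⇒clA∪γ∪𝒯 (suc zero) _ = inj₁ refl
  spanned⇒clA∪γ∪𝒯 (suc (suc x)) (false , T , T⊆A , sums) =
    inj₂ (x , refl , inj₁ (spans⇒inCl (T , T⊆A , sums ∘ suc)))
  spanned⇒clA∪γ∪𝒯 (suc (suc x)) (true , T , T⊆A , sums) =
    inj₂ (x , refl , spannedWithγ⇒clA⊎𝒯 T⊆A sums)

  clA⇒spanned : ∀ {x} → InCl M A x → SpannedByA∪γ (ι x)
  clA⇒spanned {x} x∈clA with inCl⇒spans x∈clA
  ... | T , T⊆A , sums = false , T , T⊆A , λ { zero → δ-sum ; (suc r) → sums r }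
    where
    T∪x⊆clA : SubCl M A (T ⊕ ⁅ x ⁆)
    T∪x⊆clA j j∈ = [ inj₁ ∘ T⊆A , (λ { refl → x∈clA }) ]′ (∈-⊕⁅⁆⁻ T x j∈)
    δ-sum : weight (lookup X) T ≡ lookup X x
    δ-sum = xor≡false⇒≡ (trans (sym (weight-⊕⁅⁆ (lookup X) T x))
                                (cycleInClA-even (spans⇒cycle {T = T} sums) T∪x⊆clA))

  𝒯⇒spanned : ∀ {x} → InT M X e A x → SpannedByA∪γ (ι x)
  𝒯⇒spanned {x} (x∉A , x≢e , C , (circC , oddC) , x∈C , e∈C , C⊆A∪e∪x) =
    true , C ⊕ ⁅ e ⁆ ⊕ ⁅ x ⁆ , ⊕⁅⁆⁅⁆-⊆ C⊆A∪e∪x e∈C x∈C (x≢e ∘ sym) ,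
    λ { zero → δ-sum ; (suc r) → M-sum r }
    where
    open ≡-Reasoning
    δ-sum : weight (Mₑ zero) (false ∷ true ∷ C ⊕ ⁅ e ⁆ ⊕ ⁅ x ⁆) ≡ lookup X x
    δ-sum = begin
      weight (Mₑ zero) (false ∷ true ∷ C ⊕ ⁅ e ⁆ ⊕ ⁅ x ⁆) ≡⟨ δ-row true (C ⊕ ⁅ e ⁆ ⊕ ⁅ x ⁆) ⟩
      weight (lookup X) (C ⊕ ⁅ e ⁆ ⊕ ⁅ x ⁆)              ≡⟨ weight-⊕⁅⁆⁅⁆ (lookup X) C e x ⟩
      weight (lookup X) C xor lookup X e xor lookup X x
        ≡⟨ cong₂ (λ u v → u xor v xor lookup X x) (Equivalence.to (odd⇔weight C X) oddC) ([]=⇒lookup e∈X) ⟩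
      true xor true xor lookup X x                       ≡⟨ xor-cancelˡ true (lookup X x) ⟩
      lookup X x                                         ∎
    M-sum : ∀ r → M r e xor weight (M r) (C ⊕ ⁅ e ⁆ ⊕ ⁅ x ⁆) ≡ M r x
    M-sum r = begin
      M r e xor weight (M r) (C ⊕ ⁅ e ⁆ ⊕ ⁅ x ⁆)   ≡⟨ cong (M r e xor_) (weight-⊕⁅⁆⁅⁆ (M r) C e x) ⟩
      M r e xor weight (M r) C xor M r e xor M r x
        ≡⟨ cong (λ w → M r e xor w xor M r e xor M r x) (circuit⇒cycle circC r) ⟩
      M r e xor M r e xor M r x                    ≡⟨ xor-cancelˡ (M r e) (M r x) ⟩
      M r x                                        ∎

  clA∪γ∪𝒯⇒inCl′ : ∀ y → ClA∪γ∪𝒯 y → InCl Mₑ A∪γ y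
  clA∪γ∪𝒯⇒inCl′ _ (inj₁ refl) = inj₁ (there here)
  clA∪γ∪𝒯⇒inCl′ _ (inj₂ (x , refl , inj₁ x∈clA)) = spanned⇒inCl′ (clA⇒spanned x∈clA)
  clA∪γ∪𝒯⇒inCl′ _ (inj₂ (x , refl , inj₂ x∈𝒯)) = spanned⇒inCl′ (𝒯⇒spanned x∈𝒯)

lemma3p8 : (m n : ℕ) (M : Matrix m n) (X : Subset n) (e : Fin n) → e ∈ X →
    (A' : Subset (suc (suc n))) →
    A' ≡ liftE (restrictE A') ∪ ⁅ γE ⁆ →
    ¬ (∃ λ C → OXCircuit M X C × SubCl M (restrictE A') C) →
    ¬ InCl M (restrictE A') e →
    (y : Fin (suc (suc n))) →
    InCl (esMatrix M X e) A' y ⇔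
      (y ≡ γE ⊎ (∃ λ x → y ≡ ι x × (InCl M (restrictE A') x ⊎ InT M X e (restrictE A') x)))
lemma3p8 m n M X e e∈X (_ ∷ _ ∷ A) A′≡A∪γ noOX e∉clA y
  with ∷-injectiveˡ A′≡A∪γ | ∷-injectiveˡ (∷-injectiveʳ A′≡A∪γ)
... | refl | refl = mk⇔ (spanned⇒clA∪γ∪𝒯 y ∘ inCl′⇒spanned) (clA∪γ∪𝒯⇒inCl′ y)
  where open EsSplitting M X e e∈X A noOX e∉clA
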